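{- Let $\Sigma$ be a signed graph whose underlying graph is cubic and has girth at least $4$ (so it has no loops, no multiple edges and no triangles). Then $l(\Sigma)\le \frac{3}{8}|V(\Sigma)|$.
   Context: A signed graph $\Sigma=(G,\sigma)$ consists of a graph $G$ and a sign function $\sigma: E(G)\to\{+1,-1\}$. A circle is a connected nonempty 2-regular subgraph; it is positive if the product of the signs of its edges is $+1$ and negative otherwise. $\Sigma$ is balanced if every circle is positive. The frustration index $l(\Sigma)$ is the smallest number of edges whose deletion from $\Sigma$ leaves a balanced signed graph. -}

module Defs where

open import Data.Nat using (ℕ; _+_; _*_; _≤_; _≥_)
open import Data.Bool using (Bool; true; false; _∧_; not; if_then_else_)
open import Data.Fin using (Fin; _≟_)
open import Data.List using (List; []; _∷_; length; map; allFin; foldr)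
open import Data.Nat.ListAction using (sum)
open import Data.Bool.ListAction using (any)
open import Data.List.Relation.Unary.All using (All)
open import Data.List.Relation.Unary.Unique.Propositional using (Unique)
open import Data.Product using (_×_; _,_; proj₁; proj₂)
open import Data.Sign using (Sign) renaming (_*_ to _⊛_)
open import Relation.Nullary.Decidable using (⌊_⌋)
open import Relation.Binary.PropositionalEquality using (_≡_)

-- A signed simple graph on the vertex set Fin n:
-- adjacency is a symmetric, irreflexive Bool relation, and σ gives the
-- sign of each (unordered) pair; only its values on edges matter.
record SignedGraph (n : ℕ) : Set where
  field
    adj        : Fin n → Fin n → Bool
    adj-sym    : ∀ i j → adj i j ≡ adj j i
    adj-irrefl : ∀ i → adj i i ≡ false
    σ          : Fin n → Fin n → Sign
    σ-sym      : ∀ i j → σ i j ≡ σ j i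
open SignedGraph public

degree : ∀ {n} → (Fin n → Fin n → Bool) → Fin n → ℕ
degree {n} a i = sum (map (λ j → if a i j then 1 else 0) (allFin n))

Cubic : ∀ {n} → SignedGraph n → Set
Cubic Σ = ∀ i → degree (adj Σ) i ≡ 3

TriangleFree : ∀ {n} → SignedGraph n → Set
TriangleFree Σ = ∀ i j k → adj Σ i j ≡ true → adj Σ j k ≡ true → adj Σ k i ≡ false

cyclicPairs : ∀ {A : Set} → List A → List (A × A)
cyclicPairs {A} [] = []
cyclicPairs {A} (x ∷ xs) = go (x ∷ xs)
  where
  go : List A → List (A × A)
  go [] = []
  go (y ∷ []) = (y , x) ∷ []
  go (y ∷ z ∷ zs) = (y , z) ∷ go (z ∷ zs)

IsCircle : ∀ {n} → (Fin n → Fin n → Bool) → List (Fin n) → Set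
IsCircle a vs = (length vs ≥ 3) × Unique vs × All (λ p → a (proj₁ p) (proj₂ p) ≡ true) (cyclicPairs vs)

circleSign : ∀ {n} → (Fin n → Fin n → Sign) → List (Fin n) → Sign
circleSign s vs = foldr (λ p acc → s (proj₁ p) (proj₂ p) ⊛ acc) Sign.+ (cyclicPairs vs)

Balanced : ∀ {n} → (Fin n → Fin n → Bool) → (Fin n → Fin n → Sign) → Set
Balanced a s = ∀ vs → IsCircle a vs → circleSign s vs ≡ Sign.+

listed : ∀ {n} → List (Fin n × Fin n) → Fin n → Fin n → Bool
listed D i j = any (λ p → (⌊ proj₁ p ≟ i ⌋ ∧ ⌊ proj₂ p ≟ j ⌋)) D

deleteEdges : ∀ {n} → SignedGraph n → List (Fin n × Fin n) → Fin n → Fin n → Bool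
deleteEdges Σ D i j = adj Σ i j ∧ not (listed D i j) ∧ not (listed D j i)

module Submission where

-- Choose a switching x : V → {±1} that no switching of at most three vertices improves, and
-- delete the edges it leaves frustrated; what remains is balanced, because the signs of the
-- surviving edges are the products x_i x_j.  Switching a single vertex shows that every vertex
-- meets at most one frustrated edge.  A vertex w on a frustrated edge has a neighbour meeting
-- none: otherwise w, together with its two unfrustrated neighbours, forms a set whose switching
-- unfrustrates three edges and frustrates at most two (triangle-freeness keeps the three
-- frustrated edges leaving the set).  With M vertices on frustrated edges and U = n - M others,
-- cubicity gives M ≤ 3U, so the number M/2 of deleted edges is at most 3n/8.

open import Defs
open import Algebra.Bundles using (CommutativeMonoid)
open import Data.Bool using (Bool; true; false; _∧_; _∨_; not; _xor_; if_then_else_; T)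
open import Data.Bool.Properties using (∧-conicalˡ; ∧-conicalʳ; ∧-zeroʳ; T-≡; T-∧) renaming (_≟_ to _≟ᵇ_)
open import Data.Bool.ListAction using (any)
open import Data.Empty using (⊥)
open import Data.Fin as Fin using (Fin; zero; suc; _≟_)
open import Data.Fin.Properties using (any?; <-cmp)
open import Data.List using (List; []; _∷_; length; map; foldr; concat; tabulate; drop)
open import Data.List.Properties using (length-++)
open import Data.List.Membership.Propositional using (_∈_)
open import Data.List.Membership.Propositional.Properties using (∈-concat⁺′; ∈-tabulate⁺)
open import Data.List.Relation.Unary.All using (All; []; _∷_)
open import Data.List.Relation.Unary.AllPairs using ([]; _∷_)
open import Data.List.Relation.Unary.Any using (here)
import Data.List.Relation.Unary.Any as Any
open import Data.List.Relation.Unary.Any.Properties using (any⁺)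
open import Data.List.Relation.Unary.Unique.Propositional using (Unique)
open import Data.Nat using (ℕ; zero; suc; _+_; _*_; _∸_; _≤_; _<_; _≤?_; _<?_; z≤n; s≤s)
open import Data.Nat.ListAction using () renaming (sum to sumˡ)
open import Data.Nat.Properties
  using (+-*-semiring; ≤-refl; ≤-reflexive; ≤-trans; <-≤-trans; ≤-pred; m≤m+n; m≤n+m; +-identityʳ;
         +-mono-≤; +-monoˡ-≤; +-monoʳ-≤; +-monoʳ-<; +-mono-<; +-cancelˡ-≤; +-cancelʳ-≤; +-cancelʳ-<;
         <⇒≱; ≰⇒>; ≮⇒≥; n≮0; n≢0⇒n>0; m+[n∸m]≡n; *-distribˡ-+; module ≤-Reasoning)
  renaming (_≟_ to _≟ℕ_)
open import Data.Nat.Solver using (module +-*-Solver)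
open import Data.Product using (∃; ∃₂; _×_; _,_; proj₁; proj₂)
open import Data.Sign using (Sign) renaming (_*_ to _⊛_)
open import Data.Sign.Properties using (s*s≡+; *-commutativeMonoid)
  renaming (_≟_ to _≟ˢ_; *-comm to ⊛-comm; *-identityʳ to ⊛-identityʳ)
open import Data.Sum using (_⊎_; inj₁; inj₂)
open import Function using (_∘_; id)
open import Function.Bundles using (Equivalence)
open import Relation.Binary.Definitions using (tri<; tri≈; tri>)
open import Relation.Binary.PropositionalEquality
open import Relation.Nullary using (yes; no; does; contradiction)
open import Relation.Nullary.Decidable using (⌊_⌋; dec-true; dec-false; fromWitness; _×-dec_)
open import Algebra.Properties.CommutativeSemigroup (CommutativeMonoid.commutativeSemigroup *-commutativeMonoid)
  using (interchange)
open import Algebra.Properties.Semiring.Sum +-*-semiring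
  using (sum; ∑-distrib-+; ∑-comm; sum-cong-≗; sum-remove; sum-replicate-zero; *-distribˡ-sum; *-distribʳ-sum)

𝟙 : Bool → ℕ
𝟙 b = if b then 1 else 0

∑-mono-≤ : ∀ {n} {f g : Fin n → ℕ} → (∀ i → f i ≤ g i) → sum f ≤ sum g
∑-mono-≤ {zero}  _   = z≤n
∑-mono-≤ {suc n} f≤g = +-mono-≤ (f≤g zero) (∑-mono-≤ (f≤g ∘ suc))

term≤∑ : ∀ {n} (f : Fin n → ℕ) i → f i ≤ sum f
term≤∑ {suc n} f i = ≤-trans (m≤m+n (f i) _) (≤-reflexive (sym (sum-remove {i = i} f)))

∃-term>0 : ∀ {n} (f : Fin n → ℕ) → 0 < sum f → ∃ λ i → 0 < f i
∃-term>0 {suc n} f ∑>0 with f zero in f0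
... | suc _ = zero , subst (0 <_) (sym f0) (s≤s z≤n)
... | zero  = let i , fi>0 = ∃-term>0 (f ∘ suc) ∑>0 in suc i , fi>0

∑-1 : ∀ {n} → sum {n} (λ _ → 1) ≡ n
∑-1 {zero}  = refl
∑-1 {suc n} = cong suc ∑-1

∑∑-cong : ∀ {m n} {f g : Fin m → Fin n → ℕ} → (∀ i j → f i j ≡ g i j) →
  sum (λ i → sum (f i)) ≡ sum (λ i → sum (g i))
∑∑-cong f≡g = sum-cong-≗ (sum-cong-≗ ∘ f≡g)

∑∑-distrib-+ : ∀ {m n} (f g : Fin m → Fin n → ℕ) →
  sum (λ i → sum (λ j → f i j + g i j)) ≡ sum (λ i → sum (f i)) + sum (λ i → sum (g i))
∑∑-distrib-+ {m} f g = trans (sum-cong-≗ λ i → ∑-distrib-+ (f i) (g i)) (∑-distrib-+ {m} _ _)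

sumˡ-map-tabulate : ∀ {n} {A : Set} (f : A → ℕ) (g : Fin n → A) → sumˡ (map f (tabulate g)) ≡ sum (f ∘ g)
sumˡ-map-tabulate {zero}  f g = refl
sumˡ-map-tabulate {suc n} f g = cong (f (g zero) +_) (sumˡ-map-tabulate f (g ∘ suc))

length-concat-tabulate : ∀ {n} {A : Set} (f : Fin n → List A) → length (concat (tabulate f)) ≡ sum (length ∘ f)
length-concat-tabulate {zero}  f = refl
length-concat-tabulate {suc n} f =
  trans (length-++ (f zero)) (cong (length (f zero) +_) (length-concat-tabulate (f ∘ suc)))

member : ∀ {n} → List (Fin n) → Fin n → Bool
member L i = any (λ l → does (i ≟ l)) L

member-here : ∀ {n} (l : Fin n) L → member (l ∷ L) l ≡ true
member-here l L = cong (_∨ member L l) (dec-true (l ≟ l) refl)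

member-∉ : ∀ {n} {t : Fin n} {L} → All (t ≢_) L → member L t ≡ false
member-∉ []                           = refl
member-∉ {t = t} {l ∷ _} (t≢l ∷ t∉L) = cong₂ _∨_ (dec-false (t ≟ l) t≢l) (member-∉ t∉L)

member-false⇒≢ : ∀ {n} {t l : Fin n} {L} → member (l ∷ L) t ≡ false → t ≢ l
member-false⇒≢ {l = l} {L} t∉ refl with () ← trans (sym (member-here l L)) t∉

∑-select : ∀ {n} (f : Fin n → ℕ) u → sum (λ i → 𝟙 (does (i ≟ u)) * f i) ≡ f u
∑-select {suc n} f zero    = trans (cong (1 * f zero +_) (sum-replicate-zero n)) (trans (+-identityʳ _) (+-identityʳ _))
∑-select {suc n} f (suc u) = ∑-select (f ∘ suc) u

∑-member : ∀ {n} {L : List (Fin n)} (f : Fin n → ℕ) → Unique L →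
  sum (λ i → 𝟙 (member L i) * f i) ≡ sumˡ (map f L)
∑-member {n} {[]}    f []              = sum-replicate-zero n
∑-member {n} {l ∷ L} f (l∉L ∷ unique) = begin
  sum (λ i → 𝟙 (does (i ≟ l) ∨ member L i) * f i)                           ≡⟨ sum-cong-≗ split ⟩
  sum (λ i → 𝟙 (does (i ≟ l)) * f i + 𝟙 (member L i) * f i)                 ≡⟨ ∑-distrib-+ {n} _ _ ⟩
  sum (λ i → 𝟙 (does (i ≟ l)) * f i) + sum (λ i → 𝟙 (member L i) * f i)
    ≡⟨ cong₂ _+_ (∑-select f l) (∑-member f unique) ⟩
  f l + sumˡ (map f L)                                                      ∎
  where
  open ≡-Reasoning
  split : ∀ i → 𝟙 (does (i ≟ l) ∨ member L i) * f i ≡ 𝟙 (does (i ≟ l)) * f i + 𝟙 (member L i) * f i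
  split i with i ≟ l
  ... | yes refl rewrite member-∉ l∉L = sym (+-identityʳ _)
  ... | no _     = refl

-- Degrees and cuts of Boolean relations on Fin n

deg : ∀ {n} → (Fin n → Fin n → Bool) → Fin n → ℕ
deg H i = sum (𝟙 ∘ H i)

degree≡deg : ∀ {n} (H : Fin n → Fin n → Bool) i → degree H i ≡ deg H i
degree≡deg H i = sumˡ-map-tabulate (𝟙 ∘ H i) id

edge⇒deg>0 : ∀ {n} (H : Fin n → Fin n → Bool) {i j} → H i j ≡ true → 0 < deg H i
edge⇒deg>0 H {i} {j} Hij = ≤-trans (≤-reflexive (sym (cong 𝟙 Hij))) (term≤∑ (𝟙 ∘ H i) j)

∃-edge : ∀ {n} (H : Fin n → Fin n → Bool) {i} → 0 < deg H i → ∃ λ j → H i j ≡ true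
∃-edge H {i} deg>0 with j , 𝟙>0 ← ∃-term>0 (𝟙 ∘ H i) deg>0 = j , 𝟙>0⇒true 𝟙>0
  where
  𝟙>0⇒true : ∀ {b} → 0 < 𝟙 b → b ≡ true
  𝟙>0⇒true {true} _ = refl

outDeg : ∀ {n} → (Fin n → Bool) → (Fin n → Fin n → Bool) → Fin n → ℕ
outDeg s H i = sum λ j → 𝟙 (not (s j)) * 𝟙 (H i j)

cut : ∀ {n} → (Fin n → Bool) → (Fin n → Fin n → Bool) → ℕ
cut s H = sum λ i → 𝟙 (s i) * outDeg s H i

crossing : ∀ {n} → (Fin n → Bool) → (Fin n → Fin n → Bool) → ℕ
crossing s H = sum λ i → sum λ j → 𝟙 ((s i xor s j) ∧ H i j)

module _ {n} (s : Fin n → Bool) (H : Fin n → Fin n → Bool) where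

  leaving-edge⇒outDeg>0 : ∀ {i t} → s t ≡ false → H i t ≡ true → 0 < outDeg s H i
  leaving-edge⇒outDeg>0 {i} {t} st Hit =
    ≤-trans (≤-reflexive (sym (cong₂ (λ b c → 𝟙 (not b) * 𝟙 c) st Hit))) (term≤∑ _ t)

  ∃-leaving-edge : ∀ {i} → 0 < outDeg s H i → ∃ λ j → s j ≡ false × H i j ≡ true
  ∃-leaving-edge {i} out>0 with j , term>0 ← ∃-term>0 _ out>0 = j , leaving (s j) (H i j) term>0
    where
    leaving : ∀ b c → 0 < 𝟙 (not b) * 𝟙 c → b ≡ false × c ≡ true
    leaving false true _ = refl , refl

  crossing≡cut+cut : (∀ i j → H i j ≡ H j i) → crossing s H ≡ cut s H + cut s H
  crossing≡cut+cut H-sym = begin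
    crossing s H                                      ≡⟨ ∑∑-cong both-directions ⟩
    sum (λ i → sum (λ j → leaving i j + leaving j i)) ≡⟨ ∑∑-distrib-+ leaving (λ i j → leaving j i) ⟩
    ∑∑leaving + sum (λ i → sum (λ j → leaving j i))   ≡⟨ cong (∑∑leaving +_) (∑-comm (λ i j → leaving j i)) ⟩
    ∑∑leaving + ∑∑leaving                             ≡⟨ cong₂ _+_ cut≡∑∑leaving cut≡∑∑leaving ⟨
    cut s H + cut s H                                 ∎
    where
    open ≡-Reasoning
    leaving : Fin n → Fin n → ℕ
    leaving i j = 𝟙 (s i) * (𝟙 (not (s j)) * 𝟙 (H i j))
    ∑∑leaving : ℕ
    ∑∑leaving = sum λ i → sum λ j → leaving i j
    xor-split : ∀ a b h → 𝟙 ((a xor b) ∧ h) ≡ 𝟙 a * (𝟙 (not b) * 𝟙 h) + 𝟙 b * (𝟙 (not a) * 𝟙 h)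
    xor-split false false h     = refl
    xor-split false true  false = refl
    xor-split false true  true  = refl
    xor-split true  false false = refl
    xor-split true  false true  = refl
    xor-split true  true  h     = refl
    both-directions : ∀ i j → 𝟙 ((s i xor s j) ∧ H i j) ≡ leaving i j + leaving j i
    both-directions i j = trans (xor-split (s i) (s j) (H i j))
      (cong (λ h → leaving i j + 𝟙 (s j) * (𝟙 (not (s i)) * 𝟙 h)) (H-sym i j))
    cut≡∑∑leaving : cut s H ≡ ∑∑leaving
    cut≡∑∑leaving = sum-cong-≗ λ i → *-distribˡ-sum {n} (𝟙 (s i)) _

module _ {n} {L : List (Fin n)} {H : Fin n → Fin n → Bool} (unique : Unique L) where

  outDeg-member : ∀ i → outDeg (member L) H i + sumˡ (map (𝟙 ∘ H i) L) ≡ deg H i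
  outDeg-member i = begin
    outDeg (member L) H i + sumˡ (map (𝟙 ∘ H i) L)
      ≡⟨ cong (outDeg (member L) H i +_) (∑-member (𝟙 ∘ H i) unique) ⟨
    outDeg (member L) H i + sum (λ j → 𝟙 (member L j) * 𝟙 (H i j))
      ≡⟨ ∑-distrib-+ {n} _ _ ⟨
    sum (λ j → 𝟙 (not (member L j)) * 𝟙 (H i j) + 𝟙 (member L j) * 𝟙 (H i j))
      ≡⟨ sum-cong-≗ (λ j → split (member L j) (𝟙 (H i j))) ⟩
    deg H i ∎
    where
    open ≡-Reasoning
    split : ∀ b m → 𝟙 (not b) * m + 𝟙 b * m ≡ m
    split false m = trans (+-identityʳ _) (+-identityʳ m)
    split true  m = +-identityʳ m

  cut-member : cut (member L) H ≡ sumˡ (map (outDeg (member L) H) L)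
  cut-member = ∑-member (outDeg (member L) H) unique

cut-single : ∀ {n} {H : Fin n → Fin n → Bool} u → H u u ≡ false → cut (member (u ∷ [])) H ≡ deg H u
cut-single {H = H} u Huu = begin
  cut (member (u ∷ [])) H                        ≡⟨ cut-member {H = H} ([] ∷ []) ⟩
  outDeg (member (u ∷ [])) H u + 0               ≡⟨ cong (λ b → outDeg (member (u ∷ [])) H u + (𝟙 b + 0)) Huu ⟨
  outDeg (member (u ∷ [])) H u + (𝟙 (H u u) + 0) ≡⟨ outDeg-member {H = H} ([] ∷ []) u ⟩
  deg H u                                        ∎
  where open ≡-Reasoning

two-edges : ∀ {n} (H : Fin n → Fin n → Bool) {i} → 2 ≤ deg H i →
  ∃₂ λ a b → b ≢ a × H i a ≡ true × H i b ≡ true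
two-edges H {i} deg≥2 =
  let a , Hia      = ∃-edge H (≤-trans (s≤s z≤n) deg≥2)
      b , b∉ , Hib = ∃-leaving-edge (member (a ∷ [])) H
                       (+-cancelʳ-≤ 1 1 _ (subst (2 ≤_) (sym (others a Hia)) deg≥2))
  in a , b , member-false⇒≢ {L = []} b∉ , Hia , Hib
  where
  others : ∀ a → H i a ≡ true → outDeg (member (a ∷ [])) H i + 1 ≡ deg H i
  others a Hia = trans (cong (λ h → outDeg (member (a ∷ [])) H i + (𝟙 h + 0)) (sym Hia))
                       (outDeg-member {H = H} ([] ∷ []) i)

lowerPairs : ∀ {n} → (Fin n → Fin n → Bool) → List (Fin n × Fin n)
lowerPairs H = concat (tabulate λ i → concat (tabulate λ j →
  if does (i Fin.<? j) ∧ H i j then (i , j) ∷ [] else []))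

module _ {n} {H : Fin n → Fin n → Bool} where

  length-lowerPairs : length (lowerPairs H) ≡ sum λ i → sum λ j → 𝟙 (does (i Fin.<? j) ∧ H i j)
  length-lowerPairs = trans (length-concat-tabulate {n} _) (sum-cong-≗ λ i →
    trans (length-concat-tabulate {n} _) (sum-cong-≗ λ j → length-singleton-if (does (i Fin.<? j) ∧ H i j)))
    where
    length-singleton-if : ∀ {p : Fin n × Fin n} b → length (if b then p ∷ [] else []) ≡ 𝟙 b
    length-singleton-if false = refl
    length-singleton-if true  = refl

  handshake : (∀ i j → H i j ≡ H j i) → (∀ i → H i i ≡ false) →
    sum (deg H) ≡ length (lowerPairs H) + length (lowerPairs H)
  handshake H-sym H-irrefl = begin
    sum (λ i → sum (λ j → 𝟙 (H i j)))                ≡⟨ ∑∑-cong split ⟩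
    sum (λ i → sum (λ j → lower i j + lower j i))    ≡⟨ ∑∑-distrib-+ lower (λ i j → lower j i) ⟩
    ∑∑lower + sum (λ i → sum (λ j → lower j i))      ≡⟨ cong (∑∑lower +_) (∑-comm (λ i j → lower j i)) ⟩
    ∑∑lower + ∑∑lower                                ≡⟨ cong₂ _+_ length-lowerPairs length-lowerPairs ⟨
    length (lowerPairs H) + length (lowerPairs H)    ∎
    where
    open ≡-Reasoning
    lower : Fin n → Fin n → ℕ
    lower i j = 𝟙 (does (i Fin.<? j) ∧ H i j)
    ∑∑lower : ℕ
    ∑∑lower = sum λ i → sum λ j → lower i j
    split : ∀ i j → 𝟙 (H i j) ≡ lower i j + lower j i
    split i j rewrite H-sym j i with <-cmp i j
    ... | tri< i<j _ j≮i rewrite dec-true (i Fin.<? j) i<j | dec-false (j Fin.<? i) j≮i = sym (+-identityʳ _)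
    ... | tri> i≮j _ j<i rewrite dec-false (i Fin.<? j) i≮j | dec-true (j Fin.<? i) j<i = refl
    ... | tri≈ _ refl _  rewrite H-irrefl i | ∧-zeroʳ (does (i Fin.<? i)) = refl

  lowerPairs-listed : ∀ {i j} → i Fin.< j → H i j ≡ true → listed (lowerPairs H) i j ≡ true
  lowerPairs-listed {i} {j} i<j Hij = Equivalence.to T-≡ (any⁺ isPair (Any.map matches ij∈))
    where
    isPair : Fin n × Fin n → Bool
    isPair p = ⌊ proj₁ p ≟ i ⌋ ∧ ⌊ proj₂ p ≟ j ⌋
    matches : ∀ {p} → (i , j) ≡ p → T (isPair p)
    matches refl = Equivalence.from T-∧ (fromWitness {a? = i ≟ i} refl , fromWitness {a? = j ≟ j} refl)
    singleton∈ : (i , j) ∈ (if does (i Fin.<? j) ∧ H i j then (i , j) ∷ [] else [])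
    singleton∈ rewrite dec-true (i Fin.<? j) i<j | Hij = here refl
    ij∈ : (i , j) ∈ lowerPairs H
    ij∈ = ∈-concat⁺′ (∈-concat⁺′ singleton∈ (∈-tabulate⁺ j)) (∈-tabulate⁺ i)

-- Balance from a potential

signProduct : ∀ {n} → (Fin n → Fin n → Sign) → List (Fin n × Fin n) → Sign
signProduct s = foldr (λ p acc → s (proj₁ p) (proj₂ p) ⊛ acc) Sign.+

closedWalk : ∀ {A : Set} → A → List A → List (A × A)
closedWalk e []           = []
closedWalk e (y ∷ [])     = (y , e) ∷ []
closedWalk e (y ∷ z ∷ zs) = (y , z) ∷ closedWalk e (z ∷ zs)

-- The local function behind cyclicPairs cannot be named, so the recursive call is reached
-- through cyclicPairs (v ∷ z ∷ zs) with its head pair dropped.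
cyclicPairs≡closedWalk : ∀ {A : Set} (v : A) vs → cyclicPairs (v ∷ vs) ≡ closedWalk v (v ∷ vs)
cyclicPairs≡closedWalk v []           = refl
cyclicPairs≡closedWalk v (y ∷ [])     = refl
cyclicPairs≡closedWalk v (y ∷ z ∷ zs) =
  cong (λ ps → (v , y) ∷ (y , z) ∷ drop 1 ps) (cyclicPairs≡closedWalk v (z ∷ zs))

signProduct-telescopes : ∀ {n} (x : Fin n → Sign) e y ys →
  signProduct (λ i j → x i ⊛ x j) (closedWalk e (y ∷ ys)) ≡ x y ⊛ x e
signProduct-telescopes x e y []       = ⊛-identityʳ _
signProduct-telescopes x e y (z ∷ zs) = begin
  (x y ⊛ x z) ⊛ signProduct (λ i j → x i ⊛ x j) (closedWalk e (z ∷ zs))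
    ≡⟨ cong ((x y ⊛ x z) ⊛_) (signProduct-telescopes x e z zs) ⟩
  (x y ⊛ x z) ⊛ (x z ⊛ x e) ≡⟨ cong ((x y ⊛ x z) ⊛_) (⊛-comm (x z) (x e)) ⟩
  (x y ⊛ x z) ⊛ (x e ⊛ x z) ≡⟨ interchange (x y) (x z) (x e) (x z) ⟩
  (x y ⊛ x e) ⊛ (x z ⊛ x z) ≡⟨ cong ((x y ⊛ x e) ⊛_) (s*s≡+ (x z)) ⟩
  (x y ⊛ x e) ⊛ Sign.+      ≡⟨ ⊛-identityʳ _ ⟩
  x y ⊛ x e                 ∎
  where open ≡-Reasoning

potential⇒balanced : ∀ {n} (a : Fin n → Fin n → Bool) (s : Fin n → Fin n → Sign) (x : Fin n → Sign) →
  (∀ {i j} → a i j ≡ true → s i j ≡ x i ⊛ x j) → Balanced a s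
potential⇒balanced a s x agree []       (() , _)
potential⇒balanced a s x agree (v ∷ vs) (_ , _ , edges) = begin
  signProduct s (cyclicPairs (v ∷ vs))        ≡⟨ signProduct-cong edges ⟩
  signProduct induced (cyclicPairs (v ∷ vs))  ≡⟨ cong (signProduct induced) (cyclicPairs≡closedWalk v vs) ⟩
  signProduct induced (closedWalk v (v ∷ vs)) ≡⟨ signProduct-telescopes x v v vs ⟩
  x v ⊛ x v                                   ≡⟨ s*s≡+ (x v) ⟩
  Sign.+                                      ∎
  where
  open ≡-Reasoning
  induced : Fin _ → Fin _ → Sign
  induced i j = x i ⊛ x j
  signProduct-cong : ∀ {ps} → All (λ p → a (proj₁ p) (proj₂ p) ≡ true) ps →
    signProduct s ps ≡ signProduct induced ps
  signProduct-cong []            = refl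
  signProduct-cong (aij ∷ edges) = cong₂ _⊛_ (agree aij) (signProduct-cong edges)

-- Switching

flipIf : Bool → Sign
flipIf b = if b then Sign.- else Sign.+

switch : ∀ {n} → (Fin n → Bool) → (Fin n → Sign) → Fin n → Sign
switch s x i = flipIf (s i) ⊛ x i

switch-⊛ : ∀ {n} s (x : Fin n → Sign) i j → switch s x i ⊛ switch s x j ≡ flipIf (s i xor s j) ⊛ (x i ⊛ x j)
switch-⊛ s x i j =
  trans (interchange (flipIf (s i)) (x i) (flipIf (s j)) (x j)) (cong (_⊛ (x i ⊛ x j)) (flipIf-xor (s i) (s j)))
  where
  flipIf-xor : ∀ a b → flipIf a ⊛ flipIf b ≡ flipIf (a xor b)
  flipIf-xor false false = refl
  flipIf-xor false true  = refl
  flipIf-xor true  false = refl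
  flipIf-xor true  true  = refl

flip-edge-count : ∀ b a σ p →
  𝟙 (a ∧ not (does (σ ≟ˢ flipIf b ⊛ p))) + 𝟙 (b ∧ a ∧ not (does (σ ≟ˢ p))) ≡
  𝟙 (a ∧ not (does (σ ≟ˢ p))) + 𝟙 (b ∧ a ∧ does (σ ≟ˢ p))
flip-edge-count false a     σ      p      = refl
flip-edge-count true  false σ      p      = refl
flip-edge-count true  true  Sign.+ Sign.+ = refl
flip-edge-count true  true  Sign.+ Sign.- = refl
flip-edge-count true  true  Sign.- Sign.+ = refl
flip-edge-count true  true  Sign.- Sign.- = refl

local-minimum : ∀ {A : Set} (μ : A → ℕ) {P : A → Set} → (∀ x → P x ⊎ ∃ λ y → μ y < μ x) → A → ∃ P
local-minimum {A} μ {P} step x₀ = descend (μ x₀) x₀ ≤-refl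
  where
  descend : ∀ k x → μ x ≤ k → ∃ P
  descend k x μx≤k with step x
  ... | inj₁ Px = x , Px
  descend zero    x μx≤0 | inj₂ (y , μy<μx) = contradiction (<-≤-trans μy<μx μx≤0) n≮0
  descend (suc k) x μx≤k | inj₂ (y , μy<μx) = descend k y (≤-pred (<-≤-trans μy<μx μx≤k))

-- Frustration in a signed graph

module _ {n} (Σ : SignedGraph n) where

  agrees : (Fin n → Sign) → Fin n → Fin n → Bool
  agrees x i j = does (σ Σ i j ≟ˢ x i ⊛ x j)

  satisfied frustrated : (Fin n → Sign) → Fin n → Fin n → Bool
  satisfied  x i j = adj Σ i j ∧ agrees x i j
  frustrated x i j = adj Σ i j ∧ not (agrees x i j)

  -- Each frustrated edge is counted from both ends.
  frustration : (Fin n → Sign) → ℕ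
  frustration x = sum (deg (frustrated x))

  agrees-sym : ∀ x i j → agrees x i j ≡ agrees x j i
  agrees-sym x i j = cong₂ (λ a b → does (a ≟ˢ b)) (σ-sym Σ i j) (⊛-comm (x i) (x j))

  satisfied-sym : ∀ x i j → satisfied x i j ≡ satisfied x j i
  satisfied-sym x i j = cong₂ _∧_ (adj-sym Σ i j) (agrees-sym x i j)

  frustrated-sym : ∀ x i j → frustrated x i j ≡ frustrated x j i
  frustrated-sym x i j = cong₂ (λ a g → a ∧ not g) (adj-sym Σ i j) (agrees-sym x i j)

  adj⇒≢ : ∀ {i j} → adj Σ i j ≡ true → i ≢ j
  adj⇒≢ {i} aij refl with () ← trans (sym aij) (adj-irrefl Σ i)

  satisfied⇒adj : ∀ x {i j} → satisfied x i j ≡ true → adj Σ i j ≡ true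
  satisfied⇒adj x = ∧-conicalˡ _ _

  frustrated⇒adj : ∀ x {i j} → frustrated x i j ≡ true → adj Σ i j ≡ true
  frustrated⇒adj x = ∧-conicalˡ _ _

  frustrated-not-satisfied : ∀ x {i j} → frustrated x i j ≡ true → satisfied x i j ≡ true → ⊥
  frustrated-not-satisfied x {i} {j} f s with adj Σ i j | agrees x i j
  frustrated-not-satisfied x () _ | true  | true
  frustrated-not-satisfied x _ () | true  | false
  frustrated-not-satisfied x () _ | false | _

  frustrated+satisfied : ∀ x i → deg (frustrated x) i + deg (satisfied x) i ≡ deg (adj Σ) i
  frustrated+satisfied x i =
    trans (sym (∑-distrib-+ {n} _ _)) (sum-cong-≗ λ j → split (adj Σ i j) (agrees x i j))
    where
    split : ∀ a g → 𝟙 (a ∧ not g) + 𝟙 (a ∧ g) ≡ 𝟙 a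
    split false g     = refl
    split true  false = refl
    split true  true  = refl

  -- Switching s toggles the agreement of exactly the edges crossing s.
  frustration-switch : ∀ s x →
    frustration (switch s x) + crossing s (frustrated x) ≡ frustration x + crossing s (satisfied x)
  frustration-switch s x = begin
    frustration (switch s x) + crossing s (frustrated x)
      ≡⟨ ∑∑-distrib-+ {n} {n} _ _ ⟨
    sum (λ i → sum (λ j → 𝟙 (frustrated (switch s x) i j) + 𝟙 ((s i xor s j) ∧ frustrated x i j)))
      ≡⟨ ∑∑-cong edge ⟩
    sum (λ i → sum (λ j → 𝟙 (frustrated x i j) + 𝟙 ((s i xor s j) ∧ satisfied x i j)))
      ≡⟨ ∑∑-distrib-+ {n} {n} _ _ ⟩
    frustration x + crossing s (satisfied x) ∎
    where
    open ≡-Reasoning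
    edge : ∀ i j → 𝟙 (frustrated (switch s x) i j) + 𝟙 ((s i xor s j) ∧ frustrated x i j) ≡
                   𝟙 (frustrated x i j) + 𝟙 ((s i xor s j) ∧ satisfied x i j)
    edge i j = trans
      (cong (λ p → 𝟙 (adj Σ i j ∧ not (does (σ Σ i j ≟ˢ p))) + 𝟙 ((s i xor s j) ∧ frustrated x i j))
            (switch-⊛ s x i j))
      (flip-edge-count (s i xor s j) (adj Σ i j) (σ Σ i j) (x i ⊛ x j))

  switch-improves : ∀ s x → cut s (satisfied x) < cut s (frustrated x) → frustration (switch s x) < frustration x
  switch-improves s x cutS<cutF = +-cancelʳ-< (cutS + cutS) _ _ (begin-strict
    frustration (switch s x) + (cutS + cutS)
      <⟨ +-monoʳ-< (frustration (switch s x)) (+-mono-< cutS<cutF cutS<cutF) ⟩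
    frustration (switch s x) + (cutF + cutF)
      ≡⟨ cong (frustration (switch s x) +_) (crossing≡cut+cut s (frustrated x) (frustrated-sym x)) ⟨
    frustration (switch s x) + crossing s (frustrated x)
      ≡⟨ frustration-switch s x ⟩
    frustration x + crossing s (satisfied x)
      ≡⟨ cong (frustration x +_) (crossing≡cut+cut s (satisfied x) (satisfied-sym x)) ⟩
    frustration x + (cutS + cutS) ∎)
    where
    open ≤-Reasoning
    cutS = cut s (satisfied x)
    cutF = cut s (frustrated x)

  -- Taking u = a = b covers switching a single vertex.
  LocallyOptimal : (Fin n → Sign) → Set
  LocallyOptimal x = ∀ u a b → frustration x ≤ frustration (switch (member (u ∷ a ∷ b ∷ [])) x)

  optimal-or-improvable : ∀ x → LocallyOptimal x ⊎ ∃ λ y → frustration y < frustration x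
  optimal-or-improvable x
    with any? (λ u → any? (λ a → any? (λ b →
           frustration (switch (member (u ∷ a ∷ b ∷ [])) x) <? frustration x)))
  ... | yes (u , a , b , better) = inj₂ (switch (member (u ∷ a ∷ b ∷ [])) x , better)
  ... | no none                  = inj₁ λ u a b → ≮⇒≥ λ better → none (u , a , b , better)

  switch-uuu≡switch-u : ∀ x u →
    frustration (switch (member (u ∷ u ∷ u ∷ [])) x) ≡ frustration (switch (member (u ∷ [])) x)
  switch-uuu≡switch-u x u = ∑∑-cong λ i j →
    cong₂ (λ p q → 𝟙 (adj Σ i j ∧ not (does (σ Σ i j ≟ˢ p ⊛ q)))) (same i) (same j)
    where
    idem : ∀ b → b ∨ (b ∨ (b ∨ false)) ≡ b ∨ false
    idem false = refl
    idem true  = refl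
    same : ∀ i → switch (member (u ∷ u ∷ u ∷ [])) x i ≡ switch (member (u ∷ [])) x i
    same i = cong (λ b → flipIf b ⊛ x i) (idem (does (i ≟ u)))

  unlisted-edge : ∀ {H} → (∀ i j → H i j ≡ H j i) → ∀ {i j} → adj Σ i j ≡ true →
    not (listed (lowerPairs H) i j) ≡ true → not (listed (lowerPairs H) j i) ≡ true → H i j ≡ false
  unlisted-edge {H} H-sym {i} {j} aij ¬ij ¬ji with H i j in Hij | <-cmp i j
  ... | false | _             = refl
  ... | true  | tri< i<j _ _  with () ← trans (cong not (sym (lowerPairs-listed {H = H} i<j Hij))) ¬ij
  ... | true  | tri≈ _ refl _ = contradiction refl (adj⇒≢ aij)
  ... | true  | tri> _ _ j<i  with () ← trans (cong not (sym (lowerPairs-listed {H = H} j<i (trans (H-sym j i) Hij)))) ¬ji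

  unfrustrated-edge-agrees : ∀ x {i j} → adj Σ i j ≡ true → frustrated x i j ≡ false → σ Σ i j ≡ x i ⊛ x j
  unfrustrated-edge-agrees x {i} {j} aij fij with σ Σ i j ≟ˢ x i ⊛ x j
  ... | yes agree = agree
  ... | no  _     with () ← trans (sym (cong (_∧ true) aij)) fij

  kept-agrees : ∀ x {i j} → deleteEdges Σ (lowerPairs (frustrated x)) i j ≡ true → σ Σ i j ≡ x i ⊛ x j
  kept-agrees x {i} {j} kept =
    unfrustrated-edge-agrees x aij
      (unlisted-edge (frustrated-sym x) aij (∧-conicalˡ _ _ unlisted) (∧-conicalʳ _ _ unlisted))
    where
    aij : adj Σ i j ≡ true
    aij = ∧-conicalˡ _ _ kept
    unlisted : not (listed (lowerPairs (frustrated x)) i j) ∧ not (listed (lowerPairs (frustrated x)) j i) ≡ true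
    unlisted = ∧-conicalʳ (adj Σ i j) _ kept

  module _ (cubic : Cubic Σ) where

    deg-adj≡3 : ∀ i → deg (adj Σ) i ≡ 3
    deg-adj≡3 i = trans (sym (degree≡deg (adj Σ) i)) (cubic i)

    frustrated+satisfied≡3 : ∀ x i → deg (frustrated x) i + deg (satisfied x) i ≡ 3
    frustrated+satisfied≡3 x i = trans (frustrated+satisfied x i) (deg-adj≡3 i)

    deg-satisfied≤2 : ∀ {x i} → 0 < deg (frustrated x) i → deg (satisfied x) i ≤ 2
    deg-satisfied≤2 {x} {i} F>0 =
      +-cancelˡ-≤ 1 _ 2 (≤-trans (+-monoˡ-≤ _ F>0) (≤-reflexive (frustrated+satisfied≡3 x i)))

    deg-satisfied≥2 : ∀ {x i} → deg (frustrated x) i ≤ 1 → 2 ≤ deg (satisfied x) i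
    deg-satisfied≥2 {x} {i} F≤1 =
      +-cancelˡ-≤ 1 2 _ (≤-trans (≤-reflexive (sym (frustrated+satisfied≡3 x i))) (+-monoˡ-≤ _ F≤1))

    deg-frustrated≤1 : ∀ {x} → LocallyOptimal x → ∀ u → deg (frustrated x) u ≤ 1
    deg-frustrated≤1 {x} optimal u with deg (frustrated x) u ≤? 1
    ... | yes F≤1 = F≤1
    ... | no  F≰1 = contradiction (subst (frustration x ≤_) (switch-uuu≡switch-u x u) (optimal u u u)) (<⇒≱ improved)
      where
      S≤1 : deg (satisfied x) u ≤ 1
      S≤1 = +-cancelˡ-≤ 2 _ 1 (≤-trans (+-monoˡ-≤ _ (≰⇒> F≰1)) (≤-reflexive (frustrated+satisfied≡3 x u)))
      improved : frustration (switch (member (u ∷ [])) x) < frustration x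
      improved = switch-improves (member (u ∷ [])) x (begin-strict
        cut (member (u ∷ [])) (satisfied x)  ≡⟨ cut-single u (cong (_∧ agrees x u u) (adj-irrefl Σ u)) ⟩
        deg (satisfied x) u                  ≤⟨ S≤1 ⟩
        1                                    <⟨ ≰⇒> F≰1 ⟩
        deg (frustrated x) u                 ≡⟨ cut-single u (cong (_∧ not (agrees x u u)) (adj-irrefl Σ u)) ⟨
        cut (member (u ∷ [])) (frustrated x) ∎)
        where open ≤-Reasoning

    module _ (triangleFree : TriangleFree Σ) where

      no-triangle : ∀ {i j k} → adj Σ i j ≡ true → adj Σ j k ≡ true → adj Σ k i ≡ true → ⊥
      no-triangle ij jk ki with () ← trans (sym ki) (triangleFree _ _ _ ij jk)

      -- Switching {w, a, b} unfrustrates wv, ac and bd, which leave the set since the graph has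
      -- no triangles, and frustrates at most the one remaining satisfied edge at each of a and b.
      module TripleSwitch {x : Fin n → Sign} {w v a b c d : Fin n}
        (wv : frustrated x w v ≡ true) (wa : satisfied x w a ≡ true) (wb : satisfied x w b ≡ true) (b≢a : b ≢ a)
        (ac : frustrated x a c ≡ true) (bd : frustrated x b d ≡ true) where

        S : Fin n → Bool
        S = member (w ∷ a ∷ b ∷ [])

        aw : satisfied x a w ≡ true
        aw = trans (satisfied-sym x a w) wa

        bw : satisfied x b w ≡ true
        bw = trans (satisfied-sym x b w) wb

        unique : Unique (w ∷ a ∷ b ∷ [])
        unique = (adj⇒≢ (satisfied⇒adj x wa) ∷ adj⇒≢ (satisfied⇒adj x wb) ∷ [])
               ∷ (≢-sym b≢a ∷ []) ∷ [] ∷ []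

        outside : ∀ {t} → t ≢ w → t ≢ a → t ≢ b → S t ≡ false
        outside t≢w t≢a t≢b = member-∉ (t≢w ∷ t≢a ∷ t≢b ∷ [])

        cut-frustrated≥3 : 3 ≤ cut S (frustrated x)
        cut-frustrated≥3 = subst (3 ≤_) (sym (cut-member {H = frustrated x} unique))
          (+-mono-≤ (leaving-edge⇒outDeg>0 S (frustrated x) (outside v≢w v≢a v≢b) wv)
            (+-mono-≤ (leaving-edge⇒outDeg>0 S (frustrated x) (outside c≢w c≢a c≢b) ac)
              (+-mono-≤ (leaving-edge⇒outDeg>0 S (frustrated x) (outside d≢w d≢a d≢b) bd) z≤n)))
          where
          v≢w : v ≢ w
          v≢w = ≢-sym (adj⇒≢ (frustrated⇒adj x wv))
          v≢a : v ≢ a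
          v≢a refl = frustrated-not-satisfied x wv wa
          v≢b : v ≢ b
          v≢b refl = frustrated-not-satisfied x wv wb
          c≢w : c ≢ w
          c≢w refl = frustrated-not-satisfied x ac aw
          c≢a : c ≢ a
          c≢a = ≢-sym (adj⇒≢ (frustrated⇒adj x ac))
          c≢b : c ≢ b
          c≢b refl = no-triangle (satisfied⇒adj x wa) (frustrated⇒adj x ac) (satisfied⇒adj x bw)
          d≢w : d ≢ w
          d≢w refl = frustrated-not-satisfied x bd bw
          d≢a : d ≢ a
          d≢a refl = no-triangle (satisfied⇒adj x wb) (frustrated⇒adj x bd) (satisfied⇒adj x aw)
          d≢b : d ≢ b
          d≢b = ≢-sym (adj⇒≢ (frustrated⇒adj x bd))

        cut-satisfied≤2 : cut S (satisfied x) ≤ 2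
        cut-satisfied≤2 = subst (_≤ 2) (sym (cut-member {H = satisfied x} unique))
          (+-mono-≤ (+-cancelʳ-≤ 2 _ 0 (room (edge⇒deg>0 (frustrated x) wv) inside-w))
            (+-mono-≤ (+-cancelʳ-≤ 1 _ 1 (room (edge⇒deg>0 (frustrated x) ac) inside-a))
              (+-mono-≤ (+-cancelʳ-≤ 1 _ 1 (room (edge⇒deg>0 (frustrated x) bd) inside-b)) z≤n)))
          where
          room : ∀ {i k} → 0 < deg (frustrated x) i → k ≤ sumˡ (map (𝟙 ∘ satisfied x i) (w ∷ a ∷ b ∷ [])) →
            outDeg S (satisfied x) i + k ≤ 2
          room {i} F>0 inside = ≤-trans (+-monoʳ-≤ (outDeg S (satisfied x) i) inside)
            (≤-trans (≤-reflexive (outDeg-member {H = satisfied x} unique i)) (deg-satisfied≤2 {x} F>0))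
          inside-w : 2 ≤ 𝟙 (satisfied x w w) + (𝟙 (satisfied x w a) + (𝟙 (satisfied x w b) + 0))
          inside-w rewrite wa | wb = m≤n+m 2 _
          inside-a : 1 ≤ 𝟙 (satisfied x a w) + (𝟙 (satisfied x a a) + (𝟙 (satisfied x a b) + 0))
          inside-a rewrite aw = s≤s z≤n
          inside-b : 1 ≤ 𝟙 (satisfied x b w) + (𝟙 (satisfied x b a) + (𝟙 (satisfied x b b) + 0))
          inside-b rewrite bw = s≤s z≤n

        improves : frustration (switch S x) < frustration x
        improves = switch-improves S x (≤-trans (s≤s cut-satisfied≤2) cut-frustrated≥3)

      unfrustrated-neighbour : ∀ {x} → LocallyOptimal x → ∀ w → 0 < deg (frustrated x) w →
        ∃ λ y → adj Σ w y ≡ true × deg (frustrated x) y ≡ 0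
      unfrustrated-neighbour {x} optimal w F>0
        with any? (λ y → (adj Σ w y ≟ᵇ true) ×-dec (deg (frustrated x) y ≟ℕ 0))
      ... | yes found = found
      ... | no  none  =
        let v , wv                = ∃-edge (frustrated x) F>0
            a , b , b≢a , wa , wb = two-edges (satisfied x) (deg-satisfied≥2 {x} (deg-frustrated≤1 optimal w))
            c , ac                = ∃-edge (frustrated x) (neighbour-frustrated (satisfied⇒adj x wa))
            d , bd                = ∃-edge (frustrated x) (neighbour-frustrated (satisfied⇒adj x wb))
        in contradiction (optimal w a b) (<⇒≱ (TripleSwitch.improves wv wa wb b≢a ac bd))
        where
        neighbour-frustrated : ∀ {y} → adj Σ w y ≡ true → 0 < deg (frustrated x) y
        neighbour-frustrated wy = n≢0⇒n>0 λ F≡0 → none (_ , wy , F≡0)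

      -- Since every degree in the frustrated subgraph is at most 1, the truncated difference
      -- 1 ∸ deg (frustrated x) y indicates the vertices on no frustrated edge.
      frustration+untouched≡n : ∀ {x} → LocallyOptimal x →
        frustration x + sum (λ y → 1 ∸ deg (frustrated x) y) ≡ n
      frustration+untouched≡n optimal =
        trans (sym (∑-distrib-+ {n} _ _)) (trans (sum-cong-≗ λ y → m+[n∸m]≡n (deg-frustrated≤1 optimal y)) ∑-1)

      frustration≤3*untouched : ∀ {x} → LocallyOptimal x →
        frustration x ≤ 3 * sum (λ y → 1 ∸ deg (frustrated x) y)
      frustration≤3*untouched {x} optimal = begin
        frustration x                                        ≤⟨ ∑-mono-≤ touches-untouched ⟩
        sum (λ w → sum (λ y → 𝟙 (adj Σ w y) * untouched y)) ≡⟨ ∑-comm (λ w y → 𝟙 (adj Σ w y) * untouched y) ⟩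
        sum (λ y → sum (λ w → 𝟙 (adj Σ w y) * untouched y)) ≡⟨ sum-cong-≗ cubic-weight ⟩
        sum (λ y → 3 * untouched y)                          ≡⟨ *-distribˡ-sum {n} 3 untouched ⟨
        3 * sum untouched                                    ∎
        where
        open ≤-Reasoning
        untouched : Fin n → ℕ
        untouched y = 1 ∸ deg (frustrated x) y
        ≤1⇒≤ : ∀ {m N} → m ≤ 1 → (0 < m → 0 < N) → m ≤ N
        ≤1⇒≤ z≤n       _   = z≤n
        ≤1⇒≤ (s≤s z≤n) 0<N = 0<N (s≤s z≤n)
        touches-untouched : ∀ w → deg (frustrated x) w ≤ sum (λ y → 𝟙 (adj Σ w y) * untouched y)
        touches-untouched w = ≤1⇒≤ (deg-frustrated≤1 optimal w) λ F>0 →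
          let y , wy , F≡0 = unfrustrated-neighbour optimal w F>0
          in ≤-trans (≤-reflexive (sym (cong₂ (λ e f → 𝟙 e * (1 ∸ f)) wy F≡0))) (term≤∑ _ y)
        cubic-weight : ∀ y → sum (λ w → 𝟙 (adj Σ w y) * untouched y) ≡ 3 * untouched y
        cubic-weight y = begin-equality
          sum (λ w → 𝟙 (adj Σ w y) * untouched y)
            ≡⟨ sum-cong-≗ (λ w → cong (λ e → 𝟙 e * untouched y) (adj-sym Σ w y)) ⟩
          sum (λ w → 𝟙 (adj Σ y w) * untouched y) ≡⟨ *-distribʳ-sum {n} (untouched y) (𝟙 ∘ adj Σ y) ⟨
          deg (adj Σ) y * untouched y             ≡⟨ cong (_* untouched y) (deg-adj≡3 y) ⟩
          3 * untouched y                         ∎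

      deletion-bound : ∀ {x} → LocallyOptimal x → 8 * length (lowerPairs (frustrated x)) ≤ 3 * n
      deletion-bound {x} optimal =
        8h≤3N {h = length (lowerPairs (frustrated x))}
          (handshake (frustrated-sym x) (λ i → cong (_∧ _) (adj-irrefl Σ i)))
          (frustration≤3*untouched optimal)
          (frustration+untouched≡n optimal)
        where
        8h≤3N : ∀ {M h U N} → M ≡ h + h → M ≤ 3 * U → M + U ≡ N → 8 * h ≤ 3 * N
        8h≤3N {M} {h} {U} {N} M≡2h M≤3U M+U≡N = begin
          8 * h                 ≡⟨ solve 1 (λ h → con 8 :* h := con 3 :* (h :+ h) :+ (h :+ h)) refl h ⟩
          3 * (h + h) + (h + h) ≡⟨ cong (λ t → 3 * t + t) M≡2h ⟨
          3 * M + M             ≤⟨ +-monoʳ-≤ (3 * M) M≤3U ⟩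
          3 * M + 3 * U         ≡⟨ *-distribˡ-+ 3 M U ⟨
          3 * (M + U)           ≡⟨ cong (3 *_) M+U≡N ⟩
          3 * N                 ∎
          where
          open ≤-Reasoning
          open +-*-Solver

theorem3 : ∀ (n : ℕ) (Σ : SignedGraph n) → Cubic Σ → TriangleFree Σ →
    ∃ λ (D : List (Fin n × Fin n)) → (8 * length D ≤ 3 * n) × Balanced (deleteEdges Σ D) (σ Σ)
theorem3 n Σ cubic triangleFree
  with x , optimal ← local-minimum (frustration Σ) (optimal-or-improvable Σ) (λ _ → Sign.+)
  = lowerPairs (frustrated Σ x)
  , deletion-bound Σ cubic triangleFree optimal
  , potential⇒balanced _ (σ Σ) x (kept-agrees Σ x)
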